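{- Let $G$ be a finite bipartite graph with nonempty partite sets $A$ and $B$. Then $$\sum_{\substack{S\subseteq A\\ N(S)=B}}(-1)^{|S|}=\sum_{\substack{S\subseteq B\\ N(S)=A}}(-1)^{|S|}.$$
   Context: For a vertex $w$, $N(w)$ is its set of neighbors, and for a set $W$ of vertices $N(W)=\bigcup_{w\in W}N(w)$. A sum over the empty set is $0$. -}

module Defs where

open import Data.Nat using (ℕ; zero; suc)
open import Data.Bool using (Bool; true; false; _∧_; _∨_; if_then_else_)
open import Data.Fin using (Fin)
open import Data.Fin.Subset using (Subset; inside; outside; ∣_∣; ⊤)
open import Data.Vec using (Vec; []; _∷_; tabulate; lookup; foldr′)
open import Data.List using (List; []; _∷_; map; _++_; filter)
open import Data.Integer using (ℤ; +_; -_)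
import Data.List as L
open import Data.Vec.Relation.Unary.Any using (any?)
open import Relation.Binary.PropositionalEquality using (_≡_)
open import Relation.Nullary using (Dec; yes; no)
import Data.Fin.Subset.Properties as SP

-- A finite bipartite graph with partite sets A = Fin a and B = Fin b,
-- given by its (A × B) adjacency relation (edges only go between A and B).
record BipGraph (a b : ℕ) : Set where
  field
    adj : Fin a → Fin b → Bool

open BipGraph public

swap : ∀ {a b} → BipGraph a b → BipGraph b a
swap G = record { adj = λ j i → adj G i j }

anyV : ∀ {k} → Vec Bool k → Bool
anyV = foldr′ _∨_ false

N : ∀ {a b} → BipGraph a b → Subset a → Subset b
N G S = tabulate λ j → anyV (tabulate λ i → lookup S i ∧ adj G i j)

allSubsets : (k : ℕ) → List (Subset k)
allSubsets zero = [] ∷ []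
allSubsets (suc k) = map (outside ∷_) (allSubsets k) ++ map (inside ∷_) (allSubsets k)

sign : ℕ → ℤ
sign zero = + 1
sign (suc n) = - sign n

sumℤ : List ℤ → ℤ
sumℤ = L.foldr Data.Integer._+_ (+ 0)

_≟S_ : ∀ {k} (S T : Subset k) → Dec (S ≡ T)
_≟S_ = Data.Vec.Properties.≡-dec Data.Bool._≟_
  where import Data.Vec.Properties

coverSum : ∀ {a b} → BipGraph a b → ℤ
coverSum {a} {b} G = sumℤ (map (λ S → sign ∣ S ∣) (filter (λ S → N G S ≟S ⊤) (allSubsets a)))

module Submission where

-- Write [P] for the Iverson bracket and T ∩ U for the
-- intersection of subsets of B.  For every U ⊆ B,
--     Σ_{T ⊆ B, T ∩ U = ∅} (-1)^|T|  =  [U = B]                        (★)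
-- (binomial cancellation: a nonempty complement of U makes the sum vanish).
-- Applying (★) to U = N(S) turns the left-hand side into the double sum
--     Σ_{S ⊆ A} Σ_{T ⊆ B} [no edge between S and T] (-1)^|S| (-1)^|T|,
-- because T ∩ N(S) = ∅ says exactly that no edge joins S and T.  This double
-- sum is symmetric in the roles of A and B, so exchanging the order of
-- summation gives the right-hand side.

open import Defs
open import Algebra.Bundles using (CommutativeMonoid)
import Algebra.Properties.CommutativeSemigroup as CommSemigroupProperties
open import Data.Bool using (Bool; true; false; _∧_; _∨_; not; if_then_else_)
open import Data.Bool.Properties using (∨-commutativeMonoid; ∧-commutativeMonoid; ∧-distribˡ-∨; ∧-zeroʳ)
open import Data.Fin using (Fin)
import Data.Fin as Fin
open import Data.Fin.Subset using (Subset; inside; outside; ∣_∣; ⊤)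
open import Data.Integer using (ℤ; +_; -_; _+_; _*_)
open import Data.Integer.Properties
  using (+-identityʳ; +-identityˡ; +-assoc; *-comm; *-zeroʳ; *-identityʳ;
         neg-distrib-+; +-inverseʳ; *-distribˡ-+; +-commutativeSemigroup)
open import Data.List using (List; []; _∷_; map; _++_; filter)
open import Data.Nat using (ℕ; suc; zero)
open import Data.Vec using ([]; _∷_; tabulate; lookup)
open import Data.Vec.Properties using (lookup∘tabulate)
open import Relation.Binary.PropositionalEquality using (_≡_; refl; sym; trans; cong; cong₂; module ≡-Reasoning)
open import Relation.Nullary using (Dec; does)

open ≡-Reasoning

anyF : ∀ {k} → (Fin k → Bool) → Bool
anyF {zero}  f = false
anyF {suc k} f = f Fin.zero ∨ anyF (λ i → f (Fin.suc i))

anyF-cong : ∀ {k} {f g : Fin k → Bool} → (∀ i → f i ≡ g i) → anyF f ≡ anyF g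
anyF-cong {zero}  eq = refl
anyF-cong {suc k} eq = cong₂ _∨_ (eq Fin.zero) (anyF-cong (λ i → eq (Fin.suc i)))

anyV-tabulate : ∀ {k} (f : Fin k → Bool) → anyV (tabulate f) ≡ anyF f
anyV-tabulate {zero}  f = refl
anyV-tabulate {suc k} f = cong (f Fin.zero ∨_) (anyV-tabulate (λ i → f (Fin.suc i)))

∧-anyF : ∀ {k} b (f : Fin k → Bool) → b ∧ anyF f ≡ anyF (λ i → b ∧ f i)
∧-anyF {zero}  b f = ∧-zeroʳ b
∧-anyF {suc k} b f = trans (∧-distribˡ-∨ b (f Fin.zero) _) (cong ((b ∧ f Fin.zero) ∨_) (∧-anyF b (λ i → f (Fin.suc i))))

anyF-false : ∀ k → anyF {k} (λ _ → false) ≡ false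
anyF-false zero    = refl
anyF-false (suc k) = anyF-false k

anyF-∨ : ∀ {k} (f g : Fin k → Bool) → anyF (λ i → f i ∨ g i) ≡ anyF f ∨ anyF g
anyF-∨ {zero}  f g = refl
anyF-∨ {suc k} f g =
  trans (cong ((f Fin.zero ∨ g Fin.zero) ∨_) (anyF-∨ (λ i → f (Fin.suc i)) (λ i → g (Fin.suc i))))
        (interchange (f Fin.zero) (g Fin.zero) _ _)
  where open CommSemigroupProperties (CommutativeMonoid.commutativeSemigroup ∨-commutativeMonoid)
          using (interchange)

anyF-comm : ∀ {k l} (g : Fin k → Fin l → Bool) →
  anyF (λ i → anyF (λ j → g i j)) ≡ anyF (λ j → anyF (λ i → g i j))
anyF-comm {zero}  {l} g = sym (anyF-false l)
anyF-comm {suc k} {l} g =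
  trans (cong (anyF (g Fin.zero) ∨_) (anyF-comm (λ i → g (Fin.suc i))))
        (sym (anyF-∨ (g Fin.zero) (λ j → anyF (λ i → g (Fin.suc i) j))))

sumL : ∀ {A : Set} → List A → (A → ℤ) → ℤ
sumL []       f = + 0
sumL (x ∷ xs) f = f x + sumL xs f

sumℤ-map : ∀ {A : Set} (xs : List A) (f : A → ℤ) → sumℤ (map f xs) ≡ sumL xs f
sumℤ-map []       f = refl
sumℤ-map (x ∷ xs) f = cong (_+_ (f x)) (sumℤ-map xs f)

sumL-cong : ∀ {A : Set} (xs : List A) {f g : A → ℤ} → (∀ x → f x ≡ g x) → sumL xs f ≡ sumL xs g
sumL-cong []       eq = refl
sumL-cong (x ∷ xs) eq = cong₂ _+_ (eq x) (sumL-cong xs eq)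

sumL-++ : ∀ {A : Set} (xs ys : List A) (f : A → ℤ) → sumL (xs ++ ys) f ≡ sumL xs f + sumL ys f
sumL-++ []       ys f = sym (+-identityˡ _)
sumL-++ (x ∷ xs) ys f = trans (cong (_+_ (f x)) (sumL-++ xs ys f)) (sym (+-assoc (f x) _ _))

sumL-map : ∀ {A B : Set} (xs : List A) (h : A → B) (f : B → ℤ) → sumL (map h xs) f ≡ sumL xs (λ x → f (h x))
sumL-map []       h f = refl
sumL-map (x ∷ xs) h f = cong (_+_ (f (h x))) (sumL-map xs h f)

sumL-zero : ∀ {A : Set} (xs : List A) → sumL xs (λ _ → + 0) ≡ + 0
sumL-zero []       = refl
sumL-zero (x ∷ xs) = trans (+-identityˡ _) (sumL-zero xs)

sumL-neg : ∀ {A : Set} (xs : List A) (f : A → ℤ) → sumL xs (λ x → - f x) ≡ - sumL xs f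
sumL-neg []       f = refl
sumL-neg (x ∷ xs) f = trans (cong (_+_ (- f x)) (sumL-neg xs f)) (sym (neg-distrib-+ (f x) _))

sumL-*ˡ : ∀ {A : Set} (c : ℤ) (xs : List A) (f : A → ℤ) → c * sumL xs f ≡ sumL xs (λ x → c * f x)
sumL-*ˡ c []       f = *-zeroʳ c
sumL-*ˡ c (x ∷ xs) f = trans (*-distribˡ-+ c (f x) _) (cong (_+_ (c * f x)) (sumL-*ˡ c xs f))

sumL-+ : ∀ {A : Set} (xs : List A) (f g : A → ℤ) → sumL xs (λ x → f x + g x) ≡ sumL xs f + sumL xs g
sumL-+ []       f g = refl
sumL-+ (x ∷ xs) f g =
  trans (cong (_+_ (f x + g x)) (sumL-+ xs f g)) (interchange (f x) (g x) _ _)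
  where open CommSemigroupProperties +-commutativeSemigroup using (interchange)

sumL-comm : ∀ {A B : Set} (xs : List A) (ys : List B) (f : A → B → ℤ) →
  sumL xs (λ x → sumL ys (λ y → f x y)) ≡ sumL ys (λ y → sumL xs (λ x → f x y))
sumL-comm []       ys f = sym (sumL-zero ys)
sumL-comm (x ∷ xs) ys f =
  trans (cong (_+_ (sumL ys (f x))) (sumL-comm xs ys f))
        (sym (sumL-+ ys (f x) (λ y → sumL xs (λ x → f x y))))

when : Bool → ℤ → ℤ
when b x = if b then x else + 0

sumL-filter : ∀ {A : Set} {P : A → Set} (P? : ∀ x → Dec (P x)) (xs : List A) (f : A → ℤ) →
  sumL (filter P? xs) f ≡ sumL xs (λ x → when (does (P? x)) (f x))
sumL-filter P? []       f = refl
sumL-filter P? (x ∷ xs) f with does (P? x)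
... | true  = cong (_+_ (f x)) (sumL-filter P? xs f)
... | false = trans (sumL-filter P? xs f) (sym (+-identityˡ _))

when-neg : ∀ b x → when b (- x) ≡ - when b x
when-neg true  x = refl
when-neg false x = refl

*-when : ∀ b x y → x * when b y ≡ when b (x * y)
*-when true  x y = refl
*-when false x y = *-zeroʳ x

when-as-* : ∀ b x → when b x ≡ x * when b (+ 1)
when-as-* true  x = sym (*-identityʳ x)
when-as-* false x = sym (*-zeroʳ x)

meets : ∀ {k} → Subset k → Subset k → Bool
meets T U = anyF (λ j → lookup T j ∧ lookup U j)

-- By induction on k,
-- splitting the subsets T by whether they contain the first element: if that
-- element lies in U, only T without it contribute; otherwise the two halves cancel.
alternating-disjoint : ∀ k (U : Subset k) →
  sumL (allSubsets k) (λ T → when (not (meets T U)) (sign ∣ T ∣)) ≡ when (does (U ≟S ⊤)) (+ 1)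
alternating-disjoint zero    []      = refl
alternating-disjoint (suc k) (u ∷ U) = begin
  sumL (map (outside ∷_) subsets ++ map (inside ∷_) subsets) summand
    ≡⟨ sumL-++ (map (outside ∷_) subsets) (map (inside ∷_) subsets) summand ⟩
  sumL (map (outside ∷_) subsets) summand + sumL (map (inside ∷_) subsets) summand
    ≡⟨ cong₂ _+_ (sumL-map subsets (outside ∷_) summand) (sumL-map subsets (inside ∷_) summand) ⟩
  sumL subsets (λ T → summand (outside ∷ T)) + sumL subsets (λ T → summand (inside ∷ T))
    ≡⟨ cong (_+ sumL subsets (λ T → summand (inside ∷ T))) (alternating-disjoint k U) ⟩
  when (does (U ≟S ⊤)) (+ 1) + sumL subsets (λ T → summand (inside ∷ T))
    ≡⟨ add-first-element u ⟩
  when (does ((u ∷ U) ≟S ⊤)) (+ 1) ∎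
  where
  subsets : List (Subset k)
  subsets = allSubsets k

  summand : Subset (suc k) → ℤ
  summand T = when (not (meets T (u ∷ U))) (sign ∣ T ∣)

  add-first-element : ∀ u →
    when (does (U ≟S ⊤)) (+ 1) + sumL subsets (λ T → when (not (meets (inside ∷ T) (u ∷ U))) (sign ∣ inside ∷ T ∣))
      ≡ when (does ((u ∷ U) ≟S ⊤)) (+ 1)
  add-first-element true  = trans (cong (_+_ (when (does (U ≟S ⊤)) (+ 1))) (sumL-zero subsets)) (+-identityʳ _)
  add-first-element false = begin
    top + sumL subsets (λ T → when (not (meets T U)) (- sign ∣ T ∣))
      ≡⟨ cong (_+_ top) (sumL-cong subsets (λ T → when-neg (not (meets T U)) (sign ∣ T ∣))) ⟩
    top + sumL subsets (λ T → - when (not (meets T U)) (sign ∣ T ∣))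
      ≡⟨ cong (_+_ top) (sumL-neg subsets _) ⟩
    top + - sumL subsets (λ T → when (not (meets T U)) (sign ∣ T ∣))
      ≡⟨ cong (λ s → top + - s) (alternating-disjoint k U) ⟩
    top + - top
      ≡⟨ +-inverseʳ top ⟩
    + 0 ∎
    where
    top : ℤ
    top = when (does (U ≟S ⊤)) (+ 1)

edgeBetween : ∀ {a b} → BipGraph a b → Subset a → Subset b → Bool
edgeBetween G S T = anyF (λ i → anyF (λ j → lookup S i ∧ (lookup T j ∧ adj G i j)))

edgeBetween-swap : ∀ {a b} (G : BipGraph a b) S T → edgeBetween (swap G) T S ≡ edgeBetween G S T
edgeBetween-swap G S T = begin
  anyF (λ j → anyF (λ i → lookup T j ∧ (lookup S i ∧ adj G i j)))
    ≡⟨ anyF-comm (λ j i → lookup T j ∧ (lookup S i ∧ adj G i j)) ⟩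
  anyF (λ i → anyF (λ j → lookup T j ∧ (lookup S i ∧ adj G i j)))
    ≡⟨ anyF-cong (λ i → anyF-cong (λ j → x∙yz≈y∙xz (lookup T j) (lookup S i) (adj G i j))) ⟩
  anyF (λ i → anyF (λ j → lookup S i ∧ (lookup T j ∧ adj G i j))) ∎
  where open CommSemigroupProperties (CommutativeMonoid.commutativeSemigroup ∧-commutativeMonoid)
          using (x∙yz≈y∙xz)

lookup-N : ∀ {a b} (G : BipGraph a b) S j → lookup (N G S) j ≡ anyF (λ i → lookup S i ∧ adj G i j)
lookup-N G S j =
  trans (lookup∘tabulate (λ j → anyV (tabulate λ i → lookup S i ∧ adj G i j)) j)
        (anyV-tabulate (λ i → lookup S i ∧ adj G i j))

meets-N : ∀ {a b} (G : BipGraph a b) S T → meets T (N G S) ≡ edgeBetween G S T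
meets-N G S T = begin
  anyF (λ j → lookup T j ∧ lookup (N G S) j)
    ≡⟨ anyF-cong (λ j → cong (lookup T j ∧_) (lookup-N G S j)) ⟩
  anyF (λ j → lookup T j ∧ anyF (λ i → lookup S i ∧ adj G i j))
    ≡⟨ anyF-cong (λ j → ∧-anyF (lookup T j) (λ i → lookup S i ∧ adj G i j)) ⟩
  edgeBetween (swap G) T S
    ≡⟨ edgeBetween-swap G S T ⟩
  edgeBetween G S T ∎

weight : ∀ {a b} → BipGraph a b → Subset a → Subset b → ℤ
weight G S T = when (not (edgeBetween G S T)) (sign ∣ S ∣ * sign ∣ T ∣)

weight-swap : ∀ {a b} (G : BipGraph a b) S T → weight (swap G) T S ≡ weight G S T
weight-swap G S T = cong₂ when (cong not (edgeBetween-swap G S T)) (*-comm (sign ∣ T ∣) (sign ∣ S ∣))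

-- The contribution of one S ⊆ A to coverSum, expanded by (★) with U = N(S).
cover-term : ∀ {a b} (G : BipGraph a b) S →
  when (does (N G S ≟S ⊤)) (sign ∣ S ∣) ≡ sumL (allSubsets b) (weight G S)
cover-term {b = b} G S = begin
  when (does (N G S ≟S ⊤)) (sign ∣ S ∣)
    ≡⟨ when-as-* (does (N G S ≟S ⊤)) (sign ∣ S ∣) ⟩
  sign ∣ S ∣ * when (does (N G S ≟S ⊤)) (+ 1)
    ≡⟨ cong (sign ∣ S ∣ *_) (sym (alternating-disjoint b (N G S))) ⟩
  sign ∣ S ∣ * sumL (allSubsets b) (λ T → when (not (meets T (N G S))) (sign ∣ T ∣))
    ≡⟨ sumL-*ˡ (sign ∣ S ∣) (allSubsets b) _ ⟩
  sumL (allSubsets b) (λ T → sign ∣ S ∣ * when (not (meets T (N G S))) (sign ∣ T ∣))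
    ≡⟨ sumL-cong (allSubsets b) (λ T →
         trans (*-when (not (meets T (N G S))) (sign ∣ S ∣) (sign ∣ T ∣))
               (cong (λ e → when (not e) (sign ∣ S ∣ * sign ∣ T ∣)) (meets-N G S T))) ⟩
  sumL (allSubsets b) (weight G S) ∎

coverSum-as-double-sum : ∀ {a b} (G : BipGraph a b) →
  coverSum G ≡ sumL (allSubsets a) (λ S → sumL (allSubsets b) (weight G S))
coverSum-as-double-sum {a} {b} G = begin
  coverSum G
    ≡⟨ sumℤ-map (filter covers? (allSubsets a)) (λ S → sign ∣ S ∣) ⟩
  sumL (filter covers? (allSubsets a)) (λ S → sign ∣ S ∣)
    ≡⟨ sumL-filter covers? (allSubsets a) (λ S → sign ∣ S ∣) ⟩
  sumL (allSubsets a) (λ S → when (does (covers? S)) (sign ∣ S ∣))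
    ≡⟨ sumL-cong (allSubsets a) (cover-term G) ⟩
  sumL (allSubsets a) (λ S → sumL (allSubsets b) (weight G S)) ∎
  where
  covers? : ∀ S → Dec (N G S ≡ ⊤)
  covers? S = N G S ≟S ⊤

lemma4p9 : (m n : ℕ) (G : BipGraph (suc m) (suc n)) →
    coverSum G ≡ coverSum (swap G)
lemma4p9 m n G = begin
  coverSum G
    ≡⟨ coverSum-as-double-sum G ⟩
  sumL (allSubsets (suc m)) (λ S → sumL (allSubsets (suc n)) (weight G S))
    ≡⟨ sumL-comm (allSubsets (suc m)) (allSubsets (suc n)) (weight G) ⟩
  sumL (allSubsets (suc n)) (λ T → sumL (allSubsets (suc m)) (λ S → weight G S T))
    ≡⟨ sumL-cong (allSubsets (suc n)) (λ T → sumL-cong (allSubsets (suc m)) (λ S → sym (weight-swap G S T))) ⟩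
  sumL (allSubsets (suc n)) (λ T → sumL (allSubsets (suc m)) (weight (swap G) T))
    ≡⟨ sym (coverSum-as-double-sum (swap G)) ⟩
  coverSum (swap G) ∎
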